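{- There is no $4$-cycle trade of volume $3$ and foundation greater than $8$.
   Context: A $4$-cycle $abcd$ consists of four distinct vertices and edges $\{a,b\},\{b,c\},\{c,d\},\{d,a\}$; $4$-cycles are identified with their edge sets. A set $T_1$ of pairwise edge-disjoint $4$-cycles on a vertex set is a $4$-cycle trade if there is a set $T_2$ of pairwise edge-disjoint $4$-cycles on the same vertex set with $T_1\cap T_2=\emptyset$ and $\bigcup_{C\in T_1}E(C)=\bigcup_{C\in T_2}E(C)$. Its volume is $|T_1|$ and its foundation is the number of vertices covered by the cycles of $T_1$. -}

module Defs where

open import Data.Nat using (ℕ)
open import Data.Fin using (Fin)
open import Data.Fin.Properties using (_≟_)
open import Data.List using (List; []; _∷_; length; filter; concatMap)
open import Data.List.Relation.Unary.All using (All)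
open import Data.List.Relation.Unary.Any using (Any)
open import Data.List.Relation.Unary.AllPairs using (AllPairs)
open import Data.Product using (Σ; _×_; ∃)
open import Data.Sum using (_⊎_)
open import Data.Empty using (⊥)
open import Relation.Nullary using (¬_)
open import Relation.Binary.PropositionalEquality using (_≡_)
open import Function.Bundles using (_⇔_)
import Data.List.Membership.DecPropositional as DecMem
open import Data.List using (allFin)

record Cycle4 (n : ℕ) : Set where
  constructor cyc
  field
    a b c d : Fin n
    a≢b : ¬ a ≡ b
    a≢c : ¬ a ≡ c
    a≢d : ¬ a ≡ d
    b≢c : ¬ b ≡ c
    b≢d : ¬ b ≡ d
    c≢d : ¬ c ≡ d
open Cycle4 public

SameEdge : ∀ {n} → Fin n → Fin n → Fin n → Fin n → Set
SameEdge p q x y = (x ≡ p × y ≡ q) ⊎ (x ≡ q × y ≡ p)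

HasEdge : ∀ {n} → Cycle4 n → Fin n → Fin n → Set
HasEdge C x y =
  SameEdge (a C) (b C) x y ⊎ SameEdge (b C) (c C) x y ⊎
  SameEdge (c C) (d C) x y ⊎ SameEdge (d C) (a C) x y

-- 4-cycles are identified with their edge sets
SameCycle : ∀ {n} → Cycle4 n → Cycle4 n → Set
SameCycle C D = ∀ x y → HasEdge C x y ⇔ HasEdge D x y

EdgeDisjoint : ∀ {n} → Cycle4 n → Cycle4 n → Set
EdgeDisjoint C D = ∀ x y → HasEdge C x y → HasEdge D x y → ⊥

-- A finite set of pairwise edge-disjoint 4-cycles, given as a list whose
-- entries at distinct positions are edge-disjoint (so in particular
-- distinct as edge sets; the list length is the size of the set).
PairwiseEdgeDisjoint : ∀ {n} → List (Cycle4 n) → Set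
PairwiseEdgeDisjoint = AllPairs EdgeDisjoint

InUnion : ∀ {n} → List (Cycle4 n) → Fin n → Fin n → Set
InUnion T x y = Any (λ C → HasEdge C x y) T

DisjointFamilies : ∀ {n} → List (Cycle4 n) → List (Cycle4 n) → Set
DisjointFamilies T₁ T₂ = All (λ C → All (λ D → ¬ SameCycle C D) T₂) T₁

IsTrade : ∀ {n} → List (Cycle4 n) → Set
IsTrade {n} T₁ =
  PairwiseEdgeDisjoint T₁ ×
  Σ (List (Cycle4 n)) (λ T₂ →
    PairwiseEdgeDisjoint T₂ ×
    DisjointFamilies T₁ T₂ ×
    (∀ x y → InUnion T₁ x y ⇔ InUnion T₂ x y))

volume : ∀ {n} → List (Cycle4 n) → ℕ
volume = length

vertices : ∀ {n} → Cycle4 n → List (Fin n)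
vertices C = a C ∷ b C ∷ c C ∷ d C ∷ []

foundation : ∀ {n} → List (Cycle4 n) → ℕ
foundation {n} T = length (filter (λ v → v ∈? concatMap vertices T) (allFin n))
  where open DecMem (_≟_ {n}) using (_∈?_)

-- Let C₁, C₂, C₃ form a trade with partner T₂. If a vertex b of C₁ lies on no
-- other cycle, the cycle of T₂ through the edge ab must continue along bc, the
-- only other edge at b, and, not being C₁ itself, close up through a vertex
-- y ≠ d; so cy and ya are edges of C₂ ∪ C₃. Hence every edge of each Cᵢ has an
-- endpoint on another cycle, and some two cycles share two vertices: either
-- b, c, d all lie on C₂ ∪ C₃ and two of them on the same cycle, or a path c y a
-- through C₂ ∪ C₃ joins opposite vertices of C₁. Two cycles sharing two
-- vertices cover at most 6 vertices, and the third cycle, whose edges all touch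
-- them, has at least two of its vertices among these, so at most 2 new ones.

module Submission where

open import Defs
open import Data.Nat using (ℕ; _≤_; _+_; suc; z≤n; s≤s)
open import Data.Nat.Properties using (≤-trans; +-monoˡ-≤; +-monoʳ-≤; +-cancelˡ-≤; m≤n⇒m≤1+n; +-commutativeSemigroup; module ≤-Reasoning)
open import Algebra.Properties.CommutativeSemigroup +-commutativeSemigroup using (x∙yz≈y∙xz)
open import Data.Fin using (Fin)
open import Data.Fin.Properties using (_≟_)
open import Data.List using (List; []; _∷_; _++_; length; filter; allFin)
open import Data.List.Properties using (length-++; filter-notAll)
open import Data.List.Membership.Propositional using (_∈_; lose; find)
open import Data.List.Membership.Propositional.Properties using (∈-++⁺ˡ; ∈-++⁺ʳ; ∈-filter⁺; ∈-filter⁻; ∈-concatMap⁻)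
open import Data.List.Relation.Unary.Any as Any using (Any; here; there)
open import Data.List.Relation.Unary.All as All using (All; []; _∷_)
open import Data.List.Relation.Unary.AllPairs using ([]; _∷_)
open import Data.List.Relation.Unary.Unique.Propositional using (Unique)
open import Data.List.Relation.Unary.Unique.Propositional.Properties using (allFin⁺; filter⁺)
open import Data.List.Relation.Binary.Subset.Propositional using (_⊆_)
open import Data.List.Relation.Binary.Permutation.Propositional using (_↭_; ↭-refl; ↭-sym; prep; swap; trans)
open import Data.List.Relation.Binary.Permutation.Propositional.Properties using (Any-resp-↭)
open import Data.Product using (_,_; _×_; Σ; ∃; ∃₂; proj₂)
open import Function.Base using (_∘_)
open import Data.Sum using (_⊎_; inj₁; inj₂; [_,_]′)
open import Data.Empty using (⊥-elim)
open import Relation.Nullary using (¬_; Dec; yes; no)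
open import Relation.Nullary.Decidable using (¬?)
open import Level using (0ℓ)
open import Relation.Unary using (Pred; Decidable)
open import Relation.Binary.Definitions using (DecidableEquality)
open import Relation.Binary.PropositionalEquality using (_≡_; _≢_; refl; sym; cong; ≢-sym)
import Data.List.Membership.DecPropositional as DecMembership
open import Function.Bundles using (_⇔_; mk⇔; Equivalence)
open import Function.Construct.Identity using (⇔-id)
open import Function.Construct.Symmetry using (⇔-sym)
open import Function.Construct.Composition using (_⇔-∘_)

module _ {A : Set} {P : Pred A 0ℓ} (P? : Decidable P) where

  length-filter-missing-two : ∀ {p q ys} → p ∈ ys → q ∈ ys → p ≢ q → ¬ P p → ¬ P q →
                              2 + length (filter P? ys) ≤ length ys
  length-filter-missing-two (here refl) (here refl) p≢q _ _ = ⊥-elim (p≢q refl)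
  length-filter-missing-two {ys = y ∷ ys} (here refl) (there q∈ys) _ ¬Pp ¬Pq with P? y
  ... | yes Pp = ⊥-elim (¬Pp Pp)
  ... | no _ = s≤s (filter-notAll P? ys (lose q∈ys ¬Pq))
  length-filter-missing-two {ys = y ∷ ys} (there p∈ys) (here refl) _ ¬Pp ¬Pq with P? y
  ... | yes Pq = ⊥-elim (¬Pq Pq)
  ... | no _ = s≤s (filter-notAll P? ys (lose p∈ys ¬Pp))
  length-filter-missing-two {ys = y ∷ ys} (there p∈ys) (there q∈ys) p≢q ¬Pp ¬Pq with P? y
  ... | yes _ = s≤s (length-filter-missing-two p∈ys q∈ys p≢q ¬Pp ¬Pq)
  ... | no _ = m≤n⇒m≤1+n (length-filter-missing-two p∈ys q∈ys p≢q ¬Pp ¬Pq)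

module _ {A : Set} (_≟ᴬ_ : DecidableEquality A) where
  open DecMembership _≟ᴬ_ using (_∈?_)

  Unique⇒length≤ : ∀ {xs ys : List A} → Unique xs → xs ⊆ ys → length xs ≤ length ys
  Unique⇒length≤ [] _ = z≤n
  Unique⇒length≤ {x ∷ xs} {ys} (x∉xs ∷ xs!) xs⊆ys = begin
    suc (length xs)                 ≤⟨ s≤s (Unique⇒length≤ xs! xs⊆ys-x) ⟩
    suc (length (filter x≢? ys))    ≤⟨ filter-notAll x≢? ys (Any.map (λ x≡y x≢y → x≢y x≡y) (xs⊆ys (here refl))) ⟩
    length ys                       ∎
    where
    open ≤-Reasoning
    x≢? = λ y → ¬? (x ≟ᴬ y)
    xs⊆ys-x : xs ⊆ filter x≢? ys
    xs⊆ys-x z∈xs = ∈-filter⁺ x≢? (xs⊆ys (there z∈xs)) (All.lookup x∉xs z∈xs)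

  _∪_ : List A → List A → List A
  xs ∪ ys = xs ++ filter (λ y → ¬? (y ∈? xs)) ys

  ∈-∪⁺ : ∀ {v} xs ys → v ∈ xs ⊎ v ∈ ys → v ∈ xs ∪ ys
  ∈-∪⁺ xs ys (inj₁ v∈xs) = ∈-++⁺ˡ v∈xs
  ∈-∪⁺ {v} xs ys (inj₂ v∈ys) with v ∈? xs
  ... | yes v∈xs = ∈-++⁺ˡ v∈xs
  ... | no v∉xs = ∈-++⁺ʳ xs (∈-filter⁺ (λ y → ¬? (y ∈? xs)) v∈ys v∉xs)

  length-∪ : ∀ {p q} xs ys → p ≢ q → p ∈ xs → p ∈ ys → q ∈ xs → q ∈ ys →
             2 + length (xs ∪ ys) ≤ length xs + length ys
  length-∪ {p} {q} xs ys p≢q p∈xs p∈ys q∈xs q∈ys = begin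
    2 + length (xs ∪ ys)            ≡⟨ cong (2 +_) (length-++ xs) ⟩
    2 + (length xs + length ys∖xs)  ≡⟨ x∙yz≈y∙xz 2 (length xs) _ ⟩
    length xs + (2 + length ys∖xs)  ≤⟨ +-monoʳ-≤ (length xs) (length-filter-missing-two _ p∈ys q∈ys p≢q (λ p∉xs → p∉xs p∈xs) (λ q∉xs → q∉xs q∈xs)) ⟩
    length xs + length ys           ∎
    where
    open ≤-Reasoning
    ys∖xs = filter (λ y → ¬? (y ∈? xs)) ys

module _ {n : ℕ} where

  SameEdge-sym : ∀ {p q x y : Fin n} → SameEdge p q x y → SameEdge q p x y
  SameEdge-sym (inj₁ e) = inj₂ e
  SameEdge-sym (inj₂ e) = inj₁ e

  SameEdge-flip : ∀ {p q x y : Fin n} → SameEdge p q x y → SameEdge p q y x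
  SameEdge-flip (inj₁ (x≡p , y≡q)) = inj₂ (y≡q , x≡p)
  SameEdge-flip (inj₂ (x≡q , y≡p)) = inj₁ (y≡p , x≡q)

  edge-ab : ∀ (C : Cycle4 n) → HasEdge C (a C) (b C)
  edge-ab C = inj₁ (inj₁ (refl , refl))

  edge-bc : ∀ (C : Cycle4 n) → HasEdge C (b C) (c C)
  edge-bc C = inj₂ (inj₁ (inj₁ (refl , refl)))

  edge-cd : ∀ (C : Cycle4 n) → HasEdge C (c C) (d C)
  edge-cd C = inj₂ (inj₂ (inj₁ (inj₁ (refl , refl))))

  edge-da : ∀ (C : Cycle4 n) → HasEdge C (d C) (a C)
  edge-da C = inj₂ (inj₂ (inj₂ (inj₁ (refl , refl))))

  HasEdge-sym : ∀ (C : Cycle4 n) {x y} → HasEdge C x y → HasEdge C y x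
  HasEdge-sym C (inj₁ e)               = inj₁ (SameEdge-flip e)
  HasEdge-sym C (inj₂ (inj₁ e))        = inj₂ (inj₁ (SameEdge-flip e))
  HasEdge-sym C (inj₂ (inj₂ (inj₁ e))) = inj₂ (inj₂ (inj₁ (SameEdge-flip e)))
  HasEdge-sym C (inj₂ (inj₂ (inj₂ e))) = inj₂ (inj₂ (inj₂ (SameEdge-flip e)))

  HasEdge⇒∈ˡ : ∀ (C : Cycle4 n) {x y} → HasEdge C x y → x ∈ vertices C
  HasEdge⇒∈ˡ C (inj₁ (inj₁ (refl , _)))               = here refl
  HasEdge⇒∈ˡ C (inj₁ (inj₂ (refl , _)))               = there (here refl)
  HasEdge⇒∈ˡ C (inj₂ (inj₁ (inj₁ (refl , _))))        = there (here refl)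
  HasEdge⇒∈ˡ C (inj₂ (inj₁ (inj₂ (refl , _))))        = there (there (here refl))
  HasEdge⇒∈ˡ C (inj₂ (inj₂ (inj₁ (inj₁ (refl , _))))) = there (there (here refl))
  HasEdge⇒∈ˡ C (inj₂ (inj₂ (inj₁ (inj₂ (refl , _))))) = there (there (there (here refl)))
  HasEdge⇒∈ˡ C (inj₂ (inj₂ (inj₂ (inj₁ (refl , _))))) = there (there (there (here refl)))
  HasEdge⇒∈ˡ C (inj₂ (inj₂ (inj₂ (inj₂ (refl , _))))) = here refl

  HasEdge⇒∈ʳ : ∀ (C : Cycle4 n) {x y} → HasEdge C x y → y ∈ vertices C
  HasEdge⇒∈ʳ C e = HasEdge⇒∈ˡ C (HasEdge-sym C e)

  rotate : Cycle4 n → Cycle4 n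
  rotate C = cyc (b C) (c C) (d C) (a C)
                 (b≢c C) (b≢d C) (≢-sym (a≢b C)) (c≢d C) (≢-sym (a≢c C)) (≢-sym (a≢d C))

  reflect : Cycle4 n → Cycle4 n
  reflect C = cyc (b C) (a C) (d C) (c C)
                  (≢-sym (a≢b C)) (b≢d C) (b≢c C) (a≢d C) (a≢c C) (≢-sym (c≢d C))

  rotate-same : ∀ (C : Cycle4 n) → SameCycle C (rotate C)
  rotate-same C x y = mk⇔ to from
    where
    to : HasEdge C x y → HasEdge (rotate C) x y
    to (inj₁ e)               = inj₂ (inj₂ (inj₂ e))
    to (inj₂ (inj₁ e))        = inj₁ e
    to (inj₂ (inj₂ (inj₁ e))) = inj₂ (inj₁ e)
    to (inj₂ (inj₂ (inj₂ e))) = inj₂ (inj₂ (inj₁ e))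
    from : HasEdge (rotate C) x y → HasEdge C x y
    from (inj₁ e)               = inj₂ (inj₁ e)
    from (inj₂ (inj₁ e))        = inj₂ (inj₂ (inj₁ e))
    from (inj₂ (inj₂ (inj₁ e))) = inj₂ (inj₂ (inj₂ e))
    from (inj₂ (inj₂ (inj₂ e))) = inj₁ e

  reflect-same : ∀ (C : Cycle4 n) → SameCycle C (reflect C)
  reflect-same C x y = mk⇔ to from
    where
    to : HasEdge C x y → HasEdge (reflect C) x y
    to (inj₁ e)               = inj₁ (SameEdge-sym e)
    to (inj₂ (inj₁ e))        = inj₂ (inj₂ (inj₂ (SameEdge-sym e)))
    to (inj₂ (inj₂ (inj₁ e))) = inj₂ (inj₂ (inj₁ (SameEdge-sym e)))
    to (inj₂ (inj₂ (inj₂ e))) = inj₂ (inj₁ (SameEdge-sym e))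
    from : HasEdge (reflect C) x y → HasEdge C x y
    from (inj₁ e)               = inj₁ (SameEdge-sym e)
    from (inj₂ (inj₁ e))        = inj₂ (inj₂ (inj₂ (SameEdge-sym e)))
    from (inj₂ (inj₂ (inj₁ e))) = inj₂ (inj₂ (inj₁ (SameEdge-sym e)))
    from (inj₂ (inj₂ (inj₂ e))) = inj₂ (inj₁ (SameEdge-sym e))

  StartingAt : Cycle4 n → Fin n → Fin n → Set
  StartingAt C u v = Σ (Cycle4 n) λ D → SameCycle C D × a D ≡ u × b D ≡ v

  startingAt : ∀ (C : Cycle4 n) {u v} → HasEdge C u v → StartingAt C u v
  startingAt C (inj₁ (inj₁ (refl , refl))) = C , (λ x y → ⇔-id _) , refl , refl
  startingAt C (inj₁ (inj₂ (refl , refl))) = reflect C , reflect-same C , refl , refl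
  startingAt C (inj₂ (inj₁ (inj₁ (refl , refl)))) = rotate C , rotate-same C , refl , refl
  startingAt C (inj₂ (inj₁ (inj₂ (refl , refl)))) =
    reflect C₁ , (λ x y → reflect-same C₁ x y ⇔-∘ rotate-same C x y) , refl , refl
    where C₁ = rotate C
  startingAt C (inj₂ (inj₂ (inj₁ (inj₁ (refl , refl))))) =
    C₂ , (λ x y → rotate-same C₁ x y ⇔-∘ rotate-same C x y) , refl , refl
    where C₁ = rotate C; C₂ = rotate C₁
  startingAt C (inj₂ (inj₂ (inj₁ (inj₂ (refl , refl))))) =
    reflect C₂ , (λ x y → reflect-same C₂ x y ⇔-∘ (rotate-same C₁ x y ⇔-∘ rotate-same C x y)) , refl , refl
    where C₁ = rotate C; C₂ = rotate C₁
  startingAt C (inj₂ (inj₂ (inj₂ (inj₁ (refl , refl))))) =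
    C₃ , (λ x y → rotate-same C₂ x y ⇔-∘ (rotate-same C₁ x y ⇔-∘ rotate-same C x y)) , refl , refl
    where C₁ = rotate C; C₂ = rotate C₁; C₃ = rotate C₂
  startingAt C (inj₂ (inj₂ (inj₂ (inj₂ (refl , refl))))) =
    reflect C₃ ,
    (λ x y → reflect-same C₃ x y ⇔-∘ (rotate-same C₂ x y ⇔-∘ (rotate-same C₁ x y ⇔-∘ rotate-same C x y))) ,
    refl , refl
    where C₁ = rotate C; C₂ = rotate C₁; C₃ = rotate C₂

  ≡-vertices⇒SameCycle : ∀ (C D : Cycle4 n) → a C ≡ a D → b C ≡ b D → c C ≡ c D → d C ≡ d D → SameCycle C D
  ≡-vertices⇒SameCycle (cyc _ _ _ _ _ _ _ _ _ _) (cyc _ _ _ _ _ _ _ _ _ _) refl refl refl refl x y = ⇔-id _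

  SameCycle⇒vertices⊆ : ∀ (C D : Cycle4 n) → SameCycle C D → vertices D ⊆ vertices C
  SameCycle⇒vertices⊆ C D C≈D (here refl) =
    HasEdge⇒∈ˡ C (Equivalence.from (C≈D _ _) (edge-ab D))
  SameCycle⇒vertices⊆ C D C≈D (there (here refl)) =
    HasEdge⇒∈ˡ C (Equivalence.from (C≈D _ _) (edge-bc D))
  SameCycle⇒vertices⊆ C D C≈D (there (there (here refl))) =
    HasEdge⇒∈ˡ C (Equivalence.from (C≈D _ _) (edge-cd D))
  SameCycle⇒vertices⊆ C D C≈D (there (there (there (here refl)))) =
    HasEdge⇒∈ˡ C (Equivalence.from (C≈D _ _) (edge-da D))

  neighbour-of-b : ∀ (C : Cycle4 n) {x} → HasEdge C (b C) x → x ≢ a C → x ≡ c C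
  neighbour-of-b C (inj₁ (inj₁ (b≡a , _)))               _   = ⊥-elim (a≢b C (sym b≡a))
  neighbour-of-b C (inj₁ (inj₂ (_ , x≡a)))               x≢a = ⊥-elim (x≢a x≡a)
  neighbour-of-b C (inj₂ (inj₁ (inj₁ (_ , x≡c))))        _   = x≡c
  neighbour-of-b C (inj₂ (inj₁ (inj₂ (b≡c , _))))        _   = ⊥-elim (b≢c C b≡c)
  neighbour-of-b C (inj₂ (inj₂ (inj₁ (inj₁ (b≡c , _))))) _   = ⊥-elim (b≢c C b≡c)
  neighbour-of-b C (inj₂ (inj₂ (inj₁ (inj₂ (b≡d , _))))) _   = ⊥-elim (b≢d C b≡d)
  neighbour-of-b C (inj₂ (inj₂ (inj₂ (inj₁ (b≡d , _))))) _   = ⊥-elim (b≢d C b≡d)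
  neighbour-of-b C (inj₂ (inj₂ (inj₂ (inj₂ (b≡a , _))))) _   = ⊥-elim (a≢b C (sym b≡a))

  neighbour-of-c : ∀ (C : Cycle4 n) {x} → HasEdge C (c C) x → x ≢ b C → x ≡ d C
  neighbour-of-c C e = neighbour-of-b (rotate C) (Equivalence.to (rotate-same C _ _) e)

  neighbour-of-a : ∀ (C : Cycle4 n) {x} → HasEdge C x (a C) → x ≢ b C → x ≡ d C
  neighbour-of-a C e = neighbour-of-b (reflect C) (Equivalence.to (reflect-same C _ _) (HasEdge-sym C e))

  VertexCover : (Fin n → Set) → Cycle4 n → Set
  VertexCover S C = ∀ u w → HasEdge C u w → S u ⊎ S w

  VertexCover⇒two : ∀ {S} (C : Cycle4 n) → VertexCover S C →
                    ∃₂ λ r s → r ≢ s × r ∈ vertices C × s ∈ vertices C × S r × S s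
  VertexCover⇒two C cover with cover (a C) (b C) (edge-ab C)
  ... | inj₁ Sa with cover (b C) (c C) (edge-bc C)
  ...   | inj₁ Sb = a C , b C , a≢b C , here refl , there (here refl) , Sa , Sb
  ...   | inj₂ Sc = a C , c C , a≢c C , here refl , there (there (here refl)) , Sa , Sc
  VertexCover⇒two C cover | inj₂ Sb with cover (c C) (d C) (edge-cd C)
  ...   | inj₁ Sc = b C , c C , b≢c C , there (here refl) , there (there (here refl)) , Sb , Sc
  ...   | inj₂ Sd = b C , d C , b≢d C , there (here refl) , there (there (there (here refl))) , Sb , Sd

  VertexOf : List (Cycle4 n) → Fin n → Set
  VertexOf T v = Any (λ C → v ∈ vertices C) T

  vertexOf? : ∀ T v → Dec (VertexOf T v)
  vertexOf? T v = Any.any? (λ C → v ∈? vertices C) T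
    where open DecMembership (_≟_ {n}) using (_∈?_)

  InUnion⇒VertexOfˡ : ∀ {T : List (Cycle4 n)} {x y} → InUnion T x y → VertexOf T x
  InUnion⇒VertexOfˡ = Any.map (λ {C} → HasEdge⇒∈ˡ C)

  InUnion⇒VertexOfʳ : ∀ {T : List (Cycle4 n)} {x y} → InUnion T x y → VertexOf T y
  InUnion⇒VertexOfʳ = Any.map (λ {C} → HasEdge⇒∈ʳ C)

module Exchange {n} (C : Cycle4 n) (O T₂ : List (Cycle4 n))
  (same-union : ∀ x y → InUnion (C ∷ O) x y ⇔ InUnion T₂ x y)
  (fresh : All (λ D → ¬ SameCycle C D) T₂) where

  edge-of-T₂ : ∀ {D x y} → D ∈ T₂ → HasEdge D x y → HasEdge C x y ⊎ InUnion O x y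
  edge-of-T₂ D∈T₂ e = Any.toSum (Equivalence.from (same-union _ _) (lose D∈T₂ e))

  detour : ∀ C' → SameCycle C C' → ¬ VertexOf O (b C') →
           ∃ λ y → InUnion O (c C') y × InUnion O y (a C')
  -- Matching on cyc makes the vertices of C' variables, so that the refl
  -- patterns below can identify them with those of D'.
  detour C'@(cyc _ _ _ _ _ _ _ _ _ _) C≈C' b∉O
    with D , D∈T₂ , ab∈D ← find (Equivalence.to (same-union _ _) (here (Equivalence.from (C≈C' _ _) (edge-ab C'))))
    with D' , D≈D' , refl , refl ← startingAt D ab∈D
    with edge-of-T₂ D∈T₂ (Equivalence.from (D≈D' _ _) (edge-bc D'))
  ... | inj₂ bc∈O = ⊥-elim (b∉O (InUnion⇒VertexOfˡ bc∈O))
  ... | inj₁ bc∈C with refl ← neighbour-of-b C' (Equivalence.to (C≈C' _ _) bc∈C) (≢-sym (a≢c D')) =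
    d D' , edge-in-O (edge-cd D') (λ cd∈C → neighbour-of-c C' cd∈C (≢-sym (b≢d D'))) ,
           edge-in-O (edge-da D') (λ da∈C → neighbour-of-a C' da∈C (≢-sym (b≢d D')))
    where
    d≢d' : d D' ≢ d C'
    d≢d' d≡d' = All.lookup fresh D∈T₂ (λ x y → ⇔-sym (D≈D' x y) ⇔-∘ (C'≈D' x y ⇔-∘ C≈C' x y))
      where C'≈D' = ≡-vertices⇒SameCycle C' D' refl refl refl (sym d≡d')
    edge-in-O : ∀ {x y} → HasEdge D' x y → (HasEdge C' x y → d D' ≡ d C') → InUnion O x y
    edge-in-O e forces-d with edge-of-T₂ D∈T₂ (Equivalence.from (D≈D' _ _) e)
    ... | inj₁ e∈C = ⊥-elim (d≢d' (forces-d (Equivalence.to (C≈C' _ _) e∈C)))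
    ... | inj₂ e∈O = e∈O

  others-cover : VertexCover (VertexOf O) C
  others-cover u w e with vertexOf? O u | vertexOf? O w
  ... | yes u∈O | _       = inj₁ u∈O
  ... | no _    | yes w∈O = inj₂ w∈O
  ... | no u∉O  | no w∉O
    with C' , C≈C' , refl , refl ← startingAt C (HasEdge-sym C e)
    with _ , _ , yw∈O ← detour C' C≈C' u∉O
    = ⊥-elim (w∉O (InUnion⇒VertexOfʳ yw∈O))

module _ {n : ℕ} where

  Common : Cycle4 n → Cycle4 n → Fin n → Set
  Common X Y v = v ∈ vertices X × v ∈ vertices Y

  ShareTwo : Cycle4 n → Cycle4 n → Set
  ShareTwo X Y = ∃₂ λ p q → p ≢ q × Common X Y p × Common X Y q

  ShareTwo-sym : ∀ {X Y : Cycle4 n} → ShareTwo X Y → ShareTwo Y X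
  ShareTwo-sym (p , q , p≢q , (pX , pY) , (qX , qY)) = p , q , p≢q , (pY , pX) , (qY , qX)

  SomePairShareTwo : Cycle4 n → Cycle4 n → Cycle4 n → Set
  SomePairShareTwo C₁ C₂ C₃ = ShareTwo C₁ C₂ ⊎ ShareTwo C₁ C₃ ⊎ ShareTwo C₂ C₃

  -- Relabelled as p q r s, Y has the edge rs, which touches X or Z; that gives a
  -- second common vertex with X (besides p) or with Z (besides q).
  edge-between⇒ShareTwo : ∀ (X Y Z : Cycle4 n) {p q} → VertexCover (VertexOf (X ∷ Z ∷ [])) Y →
                          p ∈ vertices X → HasEdge Y p q → q ∈ vertices Z → ShareTwo X Y ⊎ ShareTwo Y Z
  edge-between⇒ShareTwo X Y Z cover p∈X pq∈Y q∈Z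
    with D , Y≈D , refl , refl ← startingAt Y pq∈Y =
    [ opposite (a≢c D) (b≢c D) (D⊆Y (there (there (here refl))))
    , opposite (a≢d D) (b≢d D) (D⊆Y (there (there (there (here refl))))) ]′
    (cover (c D) (d D) (Equivalence.from (Y≈D _ _) (edge-cd D)))
    where
    D⊆Y = SameCycle⇒vertices⊆ Y D Y≈D
    opposite : ∀ {r} → a D ≢ r → b D ≢ r → r ∈ vertices Y → VertexOf (X ∷ Z ∷ []) r →
               ShareTwo X Y ⊎ ShareTwo Y Z
    opposite p≢r _ r∈Y (here r∈X) = inj₁ (a D , _ , p≢r , (p∈X , D⊆Y (here refl)) , (r∈X , r∈Y))
    opposite _ q≢r r∈Y (there (here r∈Z)) =
      inj₂ (b D , _ , q≢r , (D⊆Y (there (here refl)) , q∈Z) , (r∈Y , r∈Z))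

  module _ (C₁ C₂ C₃ : Cycle4 n)
           (cover₂ : VertexCover (VertexOf (C₁ ∷ C₃ ∷ [])) C₂)
           (cover₃ : VertexCover (VertexOf (C₁ ∷ C₂ ∷ [])) C₃) where

    path-through-others⇒SomePairShareTwo :
      ∀ {p q y} → p ≢ q → p ∈ vertices C₁ → q ∈ vertices C₁ →
      InUnion (C₂ ∷ C₃ ∷ []) q y → InUnion (C₂ ∷ C₃ ∷ []) y p → SomePairShareTwo C₁ C₂ C₃
    path-through-others⇒SomePairShareTwo p≢q p∈C₁ q∈C₁ (here qy∈C₂) (here yp∈C₂) =
      inj₁ (_ , _ , p≢q , (p∈C₁ , HasEdge⇒∈ʳ C₂ yp∈C₂) , (q∈C₁ , HasEdge⇒∈ˡ C₂ qy∈C₂))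
    path-through-others⇒SomePairShareTwo p≢q p∈C₁ q∈C₁ (there (here qy∈C₃)) (there (here yp∈C₃)) =
      inj₂ (inj₁ (_ , _ , p≢q , (p∈C₁ , HasEdge⇒∈ʳ C₃ yp∈C₃) , (q∈C₁ , HasEdge⇒∈ˡ C₃ qy∈C₃)))
    path-through-others⇒SomePairShareTwo _ _ q∈C₁ (here qy∈C₂) (there (here yp∈C₃)) =
      [ inj₁ , inj₂ ∘ inj₂ ]′ (edge-between⇒ShareTwo C₁ C₂ C₃ cover₂ q∈C₁ qy∈C₂ (HasEdge⇒∈ˡ C₃ yp∈C₃))
    path-through-others⇒SomePairShareTwo _ _ q∈C₁ (there (here qy∈C₃)) (here yp∈C₂) =
      [ inj₂ ∘ inj₁ , inj₂ ∘ inj₂ ∘ ShareTwo-sym {C₃} {C₂} ]′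
        (edge-between⇒ShareTwo C₁ C₃ C₂ cover₃ q∈C₁ qy∈C₃ (HasEdge⇒∈ˡ C₂ yp∈C₂))

    three-shared⇒SomePairShareTwo :
      ∀ {x y z} → x ≢ y → x ≢ z → y ≢ z → x ∈ vertices C₁ → y ∈ vertices C₁ → z ∈ vertices C₁ →
      VertexOf (C₂ ∷ C₃ ∷ []) x → VertexOf (C₂ ∷ C₃ ∷ []) y → VertexOf (C₂ ∷ C₃ ∷ []) z →
      SomePairShareTwo C₁ C₂ C₃
    three-shared⇒SomePairShareTwo x≢y _ _ x∈C₁ y∈C₁ _ (here x∈C₂) (here y∈C₂) _ =
      inj₁ (_ , _ , x≢y , (x∈C₁ , x∈C₂) , (y∈C₁ , y∈C₂))
    three-shared⇒SomePairShareTwo x≢y _ _ x∈C₁ y∈C₁ _ (there (here x∈C₃)) (there (here y∈C₃)) _ =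
      inj₂ (inj₁ (_ , _ , x≢y , (x∈C₁ , x∈C₃) , (y∈C₁ , y∈C₃)))
    three-shared⇒SomePairShareTwo _ x≢z _ x∈C₁ _ z∈C₁ (here x∈C₂) (there (here _)) (here z∈C₂) =
      inj₁ (_ , _ , x≢z , (x∈C₁ , x∈C₂) , (z∈C₁ , z∈C₂))
    three-shared⇒SomePairShareTwo _ _ y≢z _ y∈C₁ z∈C₁ (here _) (there (here y∈C₃)) (there (here z∈C₃)) =
      inj₂ (inj₁ (_ , _ , y≢z , (y∈C₁ , y∈C₃) , (z∈C₁ , z∈C₃)))
    three-shared⇒SomePairShareTwo _ _ y≢z _ y∈C₁ z∈C₁ (there (here _)) (here y∈C₂) (here z∈C₂) =
      inj₁ (_ , _ , y≢z , (y∈C₁ , y∈C₂) , (z∈C₁ , z∈C₂))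
    three-shared⇒SomePairShareTwo _ x≢z _ x∈C₁ _ z∈C₁ (there (here x∈C₃)) (here _) (there (here z∈C₃)) =
      inj₂ (inj₁ (_ , _ , x≢z , (x∈C₁ , x∈C₃) , (z∈C₁ , z∈C₃)))

    module _ (detour₁ : ∀ C' → SameCycle C₁ C' → ¬ VertexOf (C₂ ∷ C₃ ∷ []) (b C') →
                        ∃ λ y → InUnion (C₂ ∷ C₃ ∷ []) (c C') y × InUnion (C₂ ∷ C₃ ∷ []) y (a C')) where

      unshared-vertex⇒SomePairShareTwo : ∀ C' → SameCycle C₁ C' → ¬ VertexOf (C₂ ∷ C₃ ∷ []) (b C') →
                                         SomePairShareTwo C₁ C₂ C₃
      unshared-vertex⇒SomePairShareTwo C' C₁≈C' b∉O with _ , cy , ya ← detour₁ C' C₁≈C' b∉O =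
        path-through-others⇒SomePairShareTwo (a≢c C')
          (C'⊆C₁ (here refl)) (C'⊆C₁ (there (there (here refl)))) cy ya
        where C'⊆C₁ = SameCycle⇒vertices⊆ C₁ C' C₁≈C'

      some-pair-shares-two : SomePairShareTwo C₁ C₂ C₃
      some-pair-shares-two
        with vertexOf? (C₂ ∷ C₃ ∷ []) (b C₁) | vertexOf? (C₂ ∷ C₃ ∷ []) (c C₁) | vertexOf? (C₂ ∷ C₃ ∷ []) (d C₁)
      ... | no b∉O | _      | _      = unshared-vertex⇒SomePairShareTwo C₁ (λ x y → ⇔-id _) b∉O
      ... | yes _  | no c∉O | _      = unshared-vertex⇒SomePairShareTwo (rotate C₁) (rotate-same C₁) c∉O
      ... | yes _  | yes _  | no d∉O =
        unshared-vertex⇒SomePairShareTwo (rotate (rotate C₁))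
          (λ x y → rotate-same (rotate C₁) x y ⇔-∘ rotate-same C₁ x y) d∉O
      ... | yes b∈O | yes c∈O | yes d∈O =
        three-shared⇒SomePairShareTwo (b≢c C₁) (b≢d C₁) (c≢d C₁)
          (there (here refl)) (there (there (here refl))) (there (there (there (here refl)))) b∈O c∈O d∈O

  foundation-≤ : ∀ T (L : List (Fin n)) → (∀ {v} → VertexOf T v → v ∈ L) → foundation T ≤ length L
  foundation-≤ T L cover =
    Unique⇒length≤ _≟_ (filter⁺ _ (allFin⁺ n))
      (λ v∈ → cover (∈-concatMap⁻ vertices (proj₂ (∈-filter⁻ _ {xs = allFin n} v∈))))

  foundation≤8 : ∀ {X Y Z T} → ShareTwo X Y → VertexCover (VertexOf (X ∷ Y ∷ [])) Z →
                 T ↭ X ∷ Y ∷ Z ∷ [] → foundation T ≤ 8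
  foundation≤8 {X} {Y} {Z} {T} (p , q , p≢q , (p∈X , p∈Y) , (q∈X , q∈Y)) cover T↭XYZ
    with r , s , r≢s , r∈Z , s∈Z , r∈XY , s∈XY ← VertexCover⇒two Z cover =
    ≤-trans (foundation-≤ T L covered) length-L≤8
    where
    _∪ᵥ_ = _∪_ _≟_
    L₁ = vertices X ∪ᵥ vertices Y
    L  = L₁ ∪ᵥ vertices Z
    ∈L₁ : ∀ {v} → VertexOf (X ∷ Y ∷ []) v → v ∈ L₁
    ∈L₁ (here v∈X)         = ∈-∪⁺ _≟_ (vertices X) (vertices Y) (inj₁ v∈X)
    ∈L₁ (there (here v∈Y)) = ∈-∪⁺ _≟_ (vertices X) (vertices Y) (inj₂ v∈Y)
    covered : ∀ {v} → VertexOf T v → v ∈ L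
    covered v∈T with Any-resp-↭ T↭XYZ v∈T
    ... | here v∈X                 = ∈-∪⁺ _≟_ L₁ (vertices Z) (inj₁ (∈L₁ (here v∈X)))
    ... | there (here v∈Y)         = ∈-∪⁺ _≟_ L₁ (vertices Z) (inj₁ (∈L₁ (there (here v∈Y))))
    ... | there (there (here v∈Z)) = ∈-∪⁺ _≟_ L₁ (vertices Z) (inj₂ v∈Z)
    length-L₁ : 2 + length L₁ ≤ 8
    length-L₁ = length-∪ _≟_ (vertices X) (vertices Y) p≢q p∈X p∈Y q∈X q∈Y
    length-L : 2 + length L ≤ length L₁ + 4
    length-L = length-∪ _≟_ L₁ (vertices Z) r≢s (∈L₁ r∈XY) r∈Z (∈L₁ s∈XY) s∈Z
    length-L≤8 : length L ≤ 8
    length-L≤8 = +-cancelˡ-≤ 2 _ 8 (≤-trans length-L (+-monoˡ-≤ 4 (+-cancelˡ-≤ 2 _ 6 length-L₁)))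

  same-union-resp-↭ : ∀ {T T' T₂ : List (Cycle4 n)} → T ↭ T' →
                      (∀ x y → InUnion T x y ⇔ InUnion T₂ x y) → ∀ x y → InUnion T' x y ⇔ InUnion T₂ x y
  same-union-resp-↭ T↭T' same-union x y =
    mk⇔ (Equivalence.to (same-union x y) ∘ Any-resp-↭ (↭-sym T↭T'))
        (Any-resp-↭ T↭T' ∘ Equivalence.from (same-union x y))

mainTheorem8 : ∀ (n : ℕ) (T : List (Cycle4 n)) →
    IsTrade T → volume T ≡ 3 → foundation T ≤ 8
mainTheorem8 n (C₁ ∷ C₂ ∷ C₃ ∷ []) (_ , T₂ , _ , fresh₁ ∷ fresh₂ ∷ fresh₃ ∷ [] , same-union) refl =
  [ (λ share₁₂ → foundation≤8 share₁₂ E₃.others-cover ↭₁₂₃)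
  , [ (λ share₁₃ → foundation≤8 share₁₃ E₂.others-cover ↭₁₃₂)
    , (λ share₂₃ → foundation≤8 share₂₃ E₁.others-cover ↭₂₃₁) ]′ ]′
  (some-pair-shares-two C₁ C₂ C₃ E₂.others-cover E₃.others-cover E₁.detour)
  where
  ↭₁₂₃ : C₁ ∷ C₂ ∷ C₃ ∷ [] ↭ C₁ ∷ C₂ ∷ C₃ ∷ []
  ↭₁₂₃ = ↭-refl
  ↭₁₃₂ = prep C₁ (swap C₂ C₃ ↭-refl)
  ↭₂₃₁ = trans (swap C₁ C₂ ↭-refl) (prep C₂ (swap C₁ C₃ ↭-refl))
  ↭₃₁₂ = trans ↭₁₃₂ (swap C₁ C₃ ↭-refl)
  module E₁ = Exchange C₁ (C₂ ∷ C₃ ∷ []) T₂ same-union fresh₁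
  module E₂ = Exchange C₂ (C₁ ∷ C₃ ∷ []) T₂ (same-union-resp-↭ (swap C₁ C₂ ↭-refl) same-union) fresh₂
  module E₃ = Exchange C₃ (C₁ ∷ C₂ ∷ []) T₂ (same-union-resp-↭ ↭₃₁₂ same-union) fresh₃
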